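{- For all integers $k\ge 2$, $l\ge 2$ and $\gamma\ge1$ we have $n_d(k,\gamma,l)=k\gamma$. Moreover, the unique $k$-uniform hypergraph without isolated vertices having exactly $k\gamma$ vertices and distance-$l$ domination number at least $\gamma$ is the hypergraph consisting of $\gamma$ pairwise disjoint hyperedges.
   Context: A hypergraph $\mathcal{H}$ has a finite vertex set $V(\mathcal{H})$ and a family $\mathcal{E}(\mathcal{H})$ of subsets of it (hyperedges); it is $k$-uniform if all hyperedges have size $k$; a vertex is isolated if it lies in no hyperedge. A Berge path of length $l$ is a sequence $v_0,H_1,v_1,\dots,H_l,v_l$ with $v_i\in V(\mathcal{H})$ and $v_{i-1},v_i\in H_i\in\mathcal{E}(\mathcal{H})$. The distance $d_{\mathcal{H}}(u,v)$ is the length of a shortest Berge path from $u$ to $v$, and $B_l(u)$ is the set of vertices at distance at most $l$ from $u$. A set $D\subseteq V(\mathcal{H})$ is a distance-$l$ dominating set if $\bigcup_{u\in D}B_l(u)=V(\mathcal{H})$; $\gamma_d(\mathcal{H},l)$ is the minimum size of such a set. $n_d(k,\gamma,l)$ is the minimum number of vertices of a $k$-uniform hypergraph without isolated vertices with $\gamma_d(\mathcal{H},l)\ge\gamma$. -}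

module Defs where

open import Data.Nat using (ℕ; zero; suc; _≤_; _*_)
open import Data.Fin using (Fin)
open import Data.Fin.Subset using (Subset; _∈_; ∣_∣)
open import Data.Product using (Σ; ∃; _×_; _,_)
open import Data.Empty using (⊥)
open import Relation.Binary.PropositionalEquality using (_≡_)
open import Relation.Nullary using (¬_)

-- The hyperedge set
-- E(H) is the image of this family (repetitions are irrelevant).
record Hypergraph (n : ℕ) : Set where
  field
    m    : ℕ
    edge : Fin m → Subset n
open Hypergraph public

Uniform : {n : ℕ} → ℕ → Hypergraph n → Set
Uniform k H = ∀ e → ∣ edge H e ∣ ≡ k

NoIsolated : {n : ℕ} → Hypergraph n → Set
NoIsolated H = ∀ v → ∃ λ e → v ∈ edge H e

data BergePath {n : ℕ} (H : Hypergraph n) : Fin n → Fin n → ℕ → Set where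
  stop : ∀ {u} → BergePath H u u zero
  step : ∀ {u v w l} (e : Fin (m H)) → u ∈ edge H e → v ∈ edge H e →
         BergePath H v w l → BergePath H u w (suc l)

InBall : {n : ℕ} → Hypergraph n → ℕ → Fin n → Fin n → Set
InBall H l u v = ∃ λ j → j ≤ l × BergePath H u v j

DistDominating : {n : ℕ} → Hypergraph n → ℕ → Subset n → Set
DistDominating H l D = ∀ v → ∃ λ u → u ∈ D × InBall H l u v

DomNumberAtLeast : {n : ℕ} → Hypergraph n → ℕ → ℕ → Set
DomNumberAtLeast H l γ = ∀ D → DistDominating H l D → γ ≤ ∣ D ∣

-- the hyperedge set of H is exactly {F i | i : Fin γ} with the F i pairwise disjoint
-- (F i ≠ F j for i ≠ j follows from disjointness and nonemptiness when k ≥ 1)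
IsDisjointUnionOfEdges : {n : ℕ} → Hypergraph n → (γ : ℕ) → Set
IsDisjointUnionOfEdges {n} H γ =
  Σ (Fin γ → Subset n) λ F →
    (∀ i j → ¬ (i ≡ j) → ∀ v → v ∈ F i → v ∈ F j → ⊥) ×
    (∀ e → ∃ λ i → edge H e ≡ F i) ×
    (∀ i → ∃ λ e → edge H e ≡ F i)

-- A greedy maximal matching M, with one chosen vertex in each matched edge, gives a
-- distance-2 dominating set: every vertex lies in an edge that meets some matched edge.
-- Hence γ ≤ |M|, while the matched edges are disjoint k-sets, so kγ ≤ k|M| ≤ n.
-- If n = kγ and two edges e, f share a vertex w, run the greedy matching on the rest of
-- the hypergraph after declaring e ∪ f covered and dominated by w alone: now
-- |e ∪ f| + k|M| ≤ n and γ ≤ |M| + 1, forcing |e ∪ f| ≤ k, i.e. e = f. So meeting edges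
-- coincide and the γ edges of a maximal matching are all the edges.  Conversely, a
-- Berge path never leaves an edge of γ disjoint edges, so a dominating set needs a
-- vertex in each of them.
module Submission where

open import Defs
open import Data.Nat using (ℕ; zero; suc; _≤_; _<_; _+_; _*_; z≤n; s≤s; >-nonZero)
open import Data.Nat.Properties
open import Data.Fin using (Fin; zero; suc; _↑ˡ_; _↑ʳ_) renaming (_≟_ to _≟ᶠ_)
open import Data.Fin.Subset
open import Data.Fin.Subset.Properties
open import Data.Vec using ([]; _∷_; here; there; _++_)
open import Data.List using (List; []; _∷_; length; map; lookup; allFin)
open import Data.List.Membership.Propositional.Properties using (∈-allFin; ∈-lookup)
open import Data.List.Relation.Unary.All as All using (All; []; _∷_)
open import Data.List.Relation.Unary.AllPairs using (AllPairs; []; _∷_)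
open import Data.List.Relation.Unary.Any using (Any; here; there; index)
open import Data.List.Relation.Unary.Any.Properties using (lookup-index)
open import Data.Product using (Σ; ∃; _×_; _,_; proj₁; proj₂; uncurry)
open import Data.Sum using (_⊎_; inj₁; inj₂)
open import Function using (_∘_; _on_)
open import Relation.Binary.Core using (Rel)
open import Relation.Binary.Definitions using (Symmetric)
open import Relation.Binary.PropositionalEquality
open import Relation.Nullary using (yes; no; contradiction)

private
  variable
    n : ℕ
    p q r : Subset n

Disjoint : Subset n → Subset n → Set
Disjoint p q = ∀ x → x ∈ p → x ∉ q

Meets : Subset n → Subset n → Set
Meets p q = ∃ λ x → x ∈ p × x ∈ q

PairwiseDisjoint : {A : Set} → (A → Subset n) → Set
PairwiseDisjoint F = ∀ i j → i ≢ j → Disjoint (F i) (F j)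

Disjoint-sym : Disjoint p q → Disjoint q p
Disjoint-sym p#q x x∈q x∈p = p#q x x∈p x∈q

Disjoint-∪⁻ : Disjoint (p ∪ q) r → Disjoint p r × Disjoint q r
Disjoint-∪⁻ {p = p} {q} p∪q#r = (λ x → p∪q#r x ∘ p⊆p∪q q) , (λ x → p∪q#r x ∘ q⊆p∪q p q)

Disjoint-∪⁺ : Disjoint p r → Disjoint q r → Disjoint (p ∪ q) r
Disjoint-∪⁺ {p = p} {q = q} p#r q#r x x∈p∪q with x∈p∪q⁻ p q x∈p∪q
... | inj₁ x∈p = p#r x x∈p
... | inj₂ x∈q = q#r x x∈q

meets? : (p q : Subset n) → Meets p q ⊎ Disjoint p q
meets? p q with nonempty? (p ∩ q)
... | yes (x , x∈p∩q) = inj₁ (x , x∈p∩q⁻ p q x∈p∩q)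
... | no p∩q-empty    = inj₂ λ x x∈p x∈q → p∩q-empty (x , x∈p∩q⁺ (x∈p , x∈q))

∣p∣>0⇒Nonempty : ∀ {n} {p : Subset n} → 0 < ∣ p ∣ → Nonempty p
∣p∣>0⇒Nonempty {n = n} {p = p} 0<∣p∣ with nonempty? p
... | yes p≠∅ = p≠∅
... | no  p≡∅ = contradiction (trans (cong ∣_∣ (Empty-unique p≡∅)) (∣⊥∣≡0 n)) (>⇒≢ 0<∣p∣)

∣p∪q∣+∣p∩q∣≡∣p∣+∣q∣ : ∀ (p q : Subset n) → ∣ p ∪ q ∣ + ∣ p ∩ q ∣ ≡ ∣ p ∣ + ∣ q ∣
∣p∪q∣+∣p∩q∣≡∣p∣+∣q∣ []            []            = refl
∣p∪q∣+∣p∩q∣≡∣p∣+∣q∣ (inside  ∷ p) (inside  ∷ q) =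
  cong suc (trans (+-suc _ _) (trans (cong suc (∣p∪q∣+∣p∩q∣≡∣p∣+∣q∣ p q)) (sym (+-suc _ _))))
∣p∪q∣+∣p∩q∣≡∣p∣+∣q∣ (inside  ∷ p) (outside ∷ q) = cong suc (∣p∪q∣+∣p∩q∣≡∣p∣+∣q∣ p q)
∣p∪q∣+∣p∩q∣≡∣p∣+∣q∣ (outside ∷ p) (inside  ∷ q) =
  trans (cong suc (∣p∪q∣+∣p∩q∣≡∣p∣+∣q∣ p q)) (sym (+-suc _ _))
∣p∪q∣+∣p∩q∣≡∣p∣+∣q∣ (outside ∷ p) (outside ∷ q) = ∣p∪q∣+∣p∩q∣≡∣p∣+∣q∣ p q

∣p∪q∣≤∣p∣+∣q∣ : ∀ (p q : Subset n) → ∣ p ∪ q ∣ ≤ ∣ p ∣ + ∣ q ∣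
∣p∪q∣≤∣p∣+∣q∣ p q = ≤-trans (m≤m+n _ _) (≤-reflexive (∣p∪q∣+∣p∩q∣≡∣p∣+∣q∣ p q))

∣p∪q∣≡∣p∣+∣q∣ : ∀ (p q : Subset n) → Disjoint p q → ∣ p ∪ q ∣ ≡ ∣ p ∣ + ∣ q ∣
∣p∪q∣≡∣p∣+∣q∣ {n} p q p#q = begin
  ∣ p ∪ q ∣                 ≡⟨ +-identityʳ _ ⟨
  ∣ p ∪ q ∣ + 0             ≡⟨ cong (∣ p ∪ q ∣ +_) (∣⊥∣≡0 n) ⟨
  ∣ p ∪ q ∣ + ∣ ⊥ {n} ∣     ≡⟨ cong (λ c → ∣ p ∪ q ∣ + ∣ c ∣) p∩q≡⊥ ⟨
  ∣ p ∪ q ∣ + ∣ p ∩ q ∣     ≡⟨ ∣p∪q∣+∣p∩q∣≡∣p∣+∣q∣ p q ⟩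
  ∣ p ∣ + ∣ q ∣ ∎
  where
  open ≡-Reasoning
  p∩q≡⊥ : p ∩ q ≡ ⊥
  p∩q≡⊥ = Empty-unique λ (x , x∈p∩q) → uncurry (p#q x) (x∈p∩q⁻ p q x∈p∩q)

p⊆q⇒∣q∣≤∣p∣⇒p≡q : ∀ {n} {p q : Subset n} → p ⊆ q → ∣ q ∣ ≤ ∣ p ∣ → p ≡ q
p⊆q⇒∣q∣≤∣p∣⇒p≡q {p = []}          {[]}          _   _ = refl
p⊆q⇒∣q∣≤∣p∣⇒p≡q {p = inside  ∷ p} {inside  ∷ q} p⊆q (s≤s ∣q∣≤∣p∣) =
  cong (inside ∷_) (p⊆q⇒∣q∣≤∣p∣⇒p≡q (drop-∷-⊆ p⊆q) ∣q∣≤∣p∣)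
p⊆q⇒∣q∣≤∣p∣⇒p≡q {p = inside  ∷ p} {outside ∷ q} p⊆q _ = contradiction (p⊆q here) λ ()
p⊆q⇒∣q∣≤∣p∣⇒p≡q {p = outside ∷ p} {inside  ∷ q} p⊆q ∣q∣≤∣p∣ =
  contradiction (≤-trans ∣q∣≤∣p∣ (p⊆q⇒∣p∣≤∣q∣ (drop-∷-⊆ p⊆q))) (<-irrefl refl)
p⊆q⇒∣q∣≤∣p∣⇒p≡q {p = outside ∷ p} {outside ∷ q} p⊆q ∣q∣≤∣p∣ =
  cong (outside ∷_) (p⊆q⇒∣q∣≤∣p∣⇒p≡q (drop-∷-⊆ p⊆q) ∣q∣≤∣p∣)

≤∣hitting-set∣ : ∀ {g n} (F : Fin g → Subset n) → PairwiseDisjoint F →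
                 (D : Subset n) → (∀ i → Meets D (F i)) → g ≤ ∣ D ∣
≤∣hitting-set∣ {zero}  F F-disjoint D hits = z≤n
≤∣hitting-set∣ {suc g} F F-disjoint D hits with hits zero
... | d , d∈D , d∈F₀ = begin
  suc g            ≤⟨ s≤s (≤∣hitting-set∣ (F ∘ suc) F∘suc-disjoint (D - d) hits-rest) ⟩
  suc ∣ D - d ∣    ≤⟨ x∈p⇒∣p-x∣<∣p∣ d∈D ⟩
  ∣ D ∣            ∎
  where
  open ≤-Reasoning
  F∘suc-disjoint : PairwiseDisjoint (F ∘ suc)
  F∘suc-disjoint i j i≢j = F-disjoint (suc i) (suc j) λ { refl → i≢j refl }
  hits-rest : ∀ i → Meets (D - d) (F (suc i))
  hits-rest i with hits (suc i)
  ... | x , x∈D , x∈F =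
    x , x∈p∧x≢y⇒x∈p-y x∈D (λ { refl → F-disjoint zero (suc i) (λ ()) x d∈F₀ x∈F }) , x∈F

AllPairs-lookup : ∀ {a ℓ} {A : Set a} {R : Rel A ℓ} → Symmetric R → ∀ {xs} → AllPairs R xs →
                  ∀ {i j} → i ≢ j → R (lookup xs i) (lookup xs j)
AllPairs-lookup sym (_  ∷ _)   {zero}  {zero}  i≢j = contradiction refl i≢j
AllPairs-lookup sym (Rx ∷ _)   {zero}  {suc j} _   = All.lookup Rx (∈-lookup j)
AllPairs-lookup sym (Rx ∷ _)   {suc i} {zero}  _   = sym (All.lookup Rx (∈-lookup i))
AllPairs-lookup sym (_  ∷ Rxs) {suc i} {suc j} i≢j = AllPairs-lookup sym Rxs (i≢j ∘ cong suc)

Uniform⇒Nonempty : ∀ {n k} {H : Hypergraph n} → Uniform k H → 1 ≤ k → ∀ e → Nonempty (edge H e)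
Uniform⇒Nonempty uniform 1≤k e = ∣p∣>0⇒Nonempty (subst (0 <_) (sym (uniform e)) 1≤k)

module _ {n} (H : Hypergraph n) where

  _++ᵖ_ : ∀ {u v w i j} → BergePath H u v i → BergePath H v w j → BergePath H u w (i + j)
  stop               ++ᵖ q = q
  step e u∈e v∈e p   ++ᵖ q = step e u∈e v∈e (p ++ᵖ q)

  InBall-trans : ∀ {i j u v w} → InBall H i u v → InBall H j v w → InBall H (i + j) u w
  InBall-trans (a , a≤i , p) (b , b≤j , q) = a + b , +-mono-≤ a≤i b≤j , p ++ᵖ q

  edge⇒InBall₁ : ∀ {e u v} → u ∈ edge H e → v ∈ edge H e → InBall H 1 u v
  edge⇒InBall₁ {e} u∈e v∈e = 1 , ≤-refl , step e u∈e v∈e stop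

  DistDominating-mono : ∀ {i j D} → i ≤ j → DistDominating H i D → DistDominating H j D
  DistDominating-mono i≤j D-dom v with D-dom v
  ... | d , d∈D , a , a≤i , p = d , d∈D , a , ≤-trans a≤i i≤j , p

  Dominates : ℕ → Subset n → Subset n → Set
  Dominates l D U = ∀ x → x ∈ U → ∃ λ d → d ∈ D × InBall H l d x

  Dominates-∪ : ∀ {l D D′ U U′} → Dominates l D U → Dominates l D′ U′ →
                Dominates l (D ∪ D′) (U ∪ U′)
  Dominates-∪ {D = D} {D′} {U} {U′} D≻U D′≻U′ x x∈U∪U′ with x∈p∪q⁻ U U′ x∈U∪U′
  ... | inj₁ x∈U  = let d , d∈D , d~x = D≻U x x∈U in d , p⊆p∪q D′ d∈D , d~x
  ... | inj₂ x∈U′ = let d , d∈D′ , d~x = D′≻U′ x x∈U′ in d , q⊆p∪q D D′ d∈D′ , d~x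

  Dominates⇒DistDominating : ∀ {l D W} → NoIsolated H → Dominates l D W →
                             (∀ e → Meets (edge H e) W) → DistDominating H (l + 1) D
  Dominates⇒DistDominating noIsolated D≻W meets v =
    let e , v∈e        = noIsolated v
        x , x∈e , x∈W  = meets e
        d , d∈D , d~x  = D≻W x x∈W
    in  d , d∈D , InBall-trans d~x (edge⇒InBall₁ x∈e v∈e)

  path-within-edge : PairwiseDisjoint (edge H) →
                     ∀ {u v j e} → BergePath H u v j → v ∈ edge H e → u ∈ edge H e
  path-within-edge edges-disjoint stop v∈e = v∈e
  path-within-edge edges-disjoint {e = e} (step f u∈f x∈f p) v∈e with f ≟ᶠ e
  ... | yes refl = u∈f
  ... | no  f≢e  =
    contradiction (path-within-edge edges-disjoint p v∈e) (edges-disjoint f e f≢e _ x∈f)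

  PairwiseDisjoint⇒DomNumberAtLeast : PairwiseDisjoint (edge H) → (∀ e → Nonempty (edge H e)) →
                                      ∀ l → DomNumberAtLeast H l (m H)
  PairwiseDisjoint⇒DomNumberAtLeast edges-disjoint nonempty l D D-dom =
    ≤∣hitting-set∣ (edge H) edges-disjoint D hits
    where
    hits : ∀ e → Meets D (edge H e)
    hits e =
      let v , v∈e                 = nonempty e
          d , d∈D , _ , _ , d⇝v  = D-dom v
      in  d , d∈D , path-within-edge edges-disjoint d⇝v v∈e

  ⋃-edges : List (Fin (m H)) → Subset n
  ⋃-edges M = ⋃ (map (edge H) M)

  ∈⋃-edges⁻ : ∀ M {x} → x ∈ ⋃-edges M → Any (λ e → x ∈ edge H e) M
  ∈⋃-edges⁻ []      x∈⊥ = contradiction x∈⊥ ∉⊥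
  ∈⋃-edges⁻ (e ∷ M) {x} x∈⋃ with x∈p∪q⁻ (edge H e) (⋃-edges M) x∈⋃
  ... | inj₁ x∈e = here x∈e
  ... | inj₂ x∈M = there (∈⋃-edges⁻ M x∈M)

  record MaximalMatching (U : Subset n) (es : List (Fin (m H))) : Set where
    field
      matched  : List (Fin (m H))
      pairwise : AllPairs (Disjoint on edge H) matched
      avoids   : All (Disjoint U ∘ edge H) matched
      maximal  : All (λ e → Meets (edge H e) (U ∪ ⋃-edges matched)) es
  open MaximalMatching

  module _ (nonempty : ∀ e → Nonempty (edge H e)) where

    maximalMatching : ∀ U es → MaximalMatching U es
    maximalMatching U [] = record { matched = [] ; pairwise = [] ; avoids = [] ; maximal = [] }
    maximalMatching U (e ∷ es) with meets? (edge H e) U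
    ... | inj₁ (x , x∈e , x∈U) =
      record
      { matched  = matched M
      ; pairwise = pairwise M
      ; avoids   = avoids M
      ; maximal  = (x , x∈e , p⊆p∪q (⋃-edges (matched M)) x∈U) ∷ maximal M
      }
      where M = maximalMatching U es
    ... | inj₂ e#U = record
      { matched  = e ∷ matched M
      ; pairwise = All.map (proj₂ ∘ Disjoint-∪⁻) (avoids M) ∷ pairwise M
      ; avoids   = Disjoint-sym e#U ∷ All.map (proj₁ ∘ Disjoint-∪⁻) (avoids M)
      ; maximal  = (x , x∈e , q⊆p∪q U _ (p⊆p∪q (⋃-edges (matched M)) x∈e))
                   ∷ subst (λ W → All (λ f → Meets (edge H f) W) es)
                           (∪-assoc U (edge H e) _) (maximal M)
      }
      where
      M = maximalMatching (U ∪ edge H e) es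
      x = proj₁ (nonempty e)
      x∈e = proj₂ (nonempty e)

    centres : List (Fin (m H)) → Subset n
    centres M = ⋃ (map (⁅_⁆ ∘ proj₁ ∘ nonempty) M)

    ∣centres∣≤length : ∀ M → ∣ centres M ∣ ≤ length M
    ∣centres∣≤length []      = ≤-reflexive (∣⊥∣≡0 n)
    ∣centres∣≤length (e ∷ M) = begin
      ∣ ⁅ c ⁆ ∪ centres M ∣       ≤⟨ ∣p∪q∣≤∣p∣+∣q∣ ⁅ c ⁆ (centres M) ⟩
      ∣ ⁅ c ⁆ ∣ + ∣ centres M ∣   ≤⟨ +-mono-≤ (≤-reflexive (∣⁅x⁆∣≡1 c)) (∣centres∣≤length M) ⟩
      suc (length M)              ∎
      where
      open ≤-Reasoning
      c = proj₁ (nonempty e)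

    centres-dominate : ∀ M → Dominates 1 (centres M) (⋃-edges M)
    centres-dominate []      x x∈⊥ = contradiction x∈⊥ ∉⊥
    centres-dominate (e ∷ M) x x∈⋃ with x∈p∪q⁻ (edge H e) (⋃-edges M) x∈⋃
    ... | inj₁ x∈e = let c , c∈e = nonempty e in
      c , p⊆p∪q (centres M) (x∈⁅x⁆ c) , edge⇒InBall₁ c∈e x∈e
    ... | inj₂ x∈M = let d , d∈D , d~x = centres-dominate M x x∈M in
      d , q⊆p∪q _ (centres M) d∈D , d~x

  MaximalMatching⇒IsDisjointUnionOfEdges :
    (M : MaximalMatching ⊥ (allFin (m H))) →
    (∀ {x e f} → x ∈ edge H e → x ∈ edge H f → edge H e ≡ edge H f) →
    IsDisjointUnionOfEdges H (length (matched M))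
  MaximalMatching⇒IsDisjointUnionOfEdges M meeting-edges-equal =
    F , F-disjoint , (λ e → covering e (All.lookup (maximal M) (∈-allFin e)))
      , (λ i → lookup (matched M) i , refl)
    where
    F : Fin (length (matched M)) → Subset n
    F = edge H ∘ lookup (matched M)
    F-disjoint : PairwiseDisjoint F
    F-disjoint i j = AllPairs-lookup (λ {e} {f} → Disjoint-sym {p = edge H e} {q = edge H f}) (pairwise M)
    covering : ∀ e → Meets (edge H e) (⊥ ∪ ⋃-edges (matched M)) → ∃ λ i → edge H e ≡ F i
    covering e (x , x∈e , x∈⊥∪⋃) =
      let x∈f = ∈⋃-edges⁻ (matched M) (subst (x ∈_) (∪-identityˡ _) x∈⊥∪⋃)
      in  index x∈f , meeting-edges-equal x∈e (lookup-index x∈f)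

open MaximalMatching

module _ {n} {H : Hypergraph n} {k} (uniform : Uniform k H) where

  ∣U∪⋃-edges∣≡∣U∣+k*length : ∀ U M → AllPairs (Disjoint on edge H) M → All (Disjoint U ∘ edge H) M →
                             ∣ U ∪ ⋃-edges H M ∣ ≡ ∣ U ∣ + k * length M
  ∣U∪⋃-edges∣≡∣U∣+k*length U [] [] [] = begin
    ∣ U ∪ ⊥ ∣        ≡⟨ cong ∣_∣ (∪-identityʳ U) ⟩
    ∣ U ∣            ≡⟨ +-identityʳ _ ⟨
    ∣ U ∣ + 0        ≡⟨ cong (∣ U ∣ +_) (*-zeroʳ k) ⟨
    ∣ U ∣ + k * 0    ∎
    where open ≡-Reasoning
  ∣U∪⋃-edges∣≡∣U∣+k*length U (f ∷ M) (f#M ∷ M-pairwise) (U#f ∷ U#M) = begin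
    ∣ U ∪ (edge H f ∪ ⋃-edges H M) ∣        ≡⟨ cong ∣_∣ (∪-assoc U (edge H f) _) ⟨
    ∣ (U ∪ edge H f) ∪ ⋃-edges H M ∣        ≡⟨ ∣U∪⋃-edges∣≡∣U∣+k*length (U ∪ edge H f) M M-pairwise U∪f#M ⟩
    ∣ U ∪ edge H f ∣ + k * length M         ≡⟨ cong (_+ k * length M) (∣p∪q∣≡∣p∣+∣q∣ U (edge H f) U#f) ⟩
    ∣ U ∣ + ∣ edge H f ∣ + k * length M     ≡⟨ cong (λ c → ∣ U ∣ + c + k * length M) (uniform f) ⟩
    ∣ U ∣ + k + k * length M                ≡⟨ +-assoc ∣ U ∣ k _ ⟩
    ∣ U ∣ + (k + k * length M)              ≡⟨ cong (∣ U ∣ +_) (*-suc k (length M)) ⟨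
    ∣ U ∣ + k * suc (length M)              ∎
    where
    open ≡-Reasoning
    U∪f#M : All (Disjoint (U ∪ edge H f) ∘ edge H) M
    U∪f#M = All.zipWith (uncurry Disjoint-∪⁺) (U#M , f#M)

  ∣U∣+k*∣matching∣≤n : ∀ {U es} (M : MaximalMatching H U es) → ∣ U ∣ + k * length (matched M) ≤ n
  ∣U∣+k*∣matching∣≤n {U} M = begin
    ∣ U ∣ + k * length (matched M)    ≡⟨ ∣U∪⋃-edges∣≡∣U∣+k*length U (matched M) (pairwise M) (avoids M) ⟨
    ∣ U ∪ ⋃-edges H (matched M) ∣     ≤⟨ ∣p∣≤n (U ∪ ⋃-edges H (matched M)) ⟩
    n                                 ∎
    where open ≤-Reasoning

  module _ (1≤k : 1 ≤ k) (noIsolated : NoIsolated H)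
           {l} (2≤l : 2 ≤ l) {γ} (γ≤γd : DomNumberAtLeast H l γ) where

    nonempty : ∀ e → Nonempty (edge H e)
    nonempty = Uniform⇒Nonempty uniform 1≤k

    γ≤∣D∣+∣matching∣ : ∀ {D U} → Dominates H 1 D U → (M : MaximalMatching H U (allFin (m H))) →
                       γ ≤ ∣ D ∣ + length (matched M)
    γ≤∣D∣+∣matching∣ {D} {U} D≻U M = begin
      γ                           ≤⟨ γ≤γd (D ∪ C) D∪C-dominating ⟩
      ∣ D ∪ C ∣                   ≤⟨ ∣p∪q∣≤∣p∣+∣q∣ D C ⟩
      ∣ D ∣ + ∣ C ∣               ≤⟨ +-monoʳ-≤ ∣ D ∣ (∣centres∣≤length H nonempty (matched M)) ⟩
      ∣ D ∣ + length (matched M)  ∎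
      where
      open ≤-Reasoning
      C = centres H nonempty (matched M)
      D∪C-dominating : DistDominating H l (D ∪ C)
      D∪C-dominating =
        DistDominating-mono H 2≤l
          (Dominates⇒DistDominating H noIsolated
            (Dominates-∪ H D≻U (centres-dominate H nonempty (matched M)))
            (λ e → All.lookup (maximal M) (∈-allFin e)))

    matching₀ : MaximalMatching H ⊥ (allFin (m H))
    matching₀ = maximalMatching H nonempty ⊥ (allFin (m H))

    γ≤∣matching₀∣ : γ ≤ length (matched matching₀)
    γ≤∣matching₀∣ = subst (λ c → γ ≤ c + length (matched matching₀)) (∣⊥∣≡0 n)
                      (γ≤∣D∣+∣matching∣ {D = ⊥} (λ x x∈⊥ → contradiction x∈⊥ ∉⊥) matching₀)

    k*∣matching₀∣≤n : k * length (matched matching₀) ≤ n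
    k*∣matching₀∣≤n = subst (λ c → c + k * length (matched matching₀) ≤ n) (∣⊥∣≡0 n)
                        (∣U∣+k*∣matching∣≤n matching₀)

    k*γ≤n : k * γ ≤ n
    k*γ≤n = ≤-trans (*-monoʳ-≤ k γ≤∣matching₀∣) k*∣matching₀∣≤n

    module _ (n≤k*γ : n ≤ k * γ) where

      meeting-edges⇒∣∪∣≤k : ∀ {w e f} → w ∈ edge H e → w ∈ edge H f → ∣ edge H e ∪ edge H f ∣ ≤ k
      meeting-edges⇒∣∪∣≤k {w} {e} {f} w∈e w∈f = +-cancelʳ-≤ (k * L) _ _ (begin
        ∣ edge H e ∪ edge H f ∣ + k * L   ≤⟨ ∣U∣+k*∣matching∣≤n M ⟩
        n                                 ≤⟨ n≤k*γ ⟩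
        k * γ                             ≤⟨ *-monoʳ-≤ k (γ≤∣D∣+∣matching∣ w≻e∪f M) ⟩
        k * (∣ ⁅ w ⁆ ∣ + L)               ≡⟨ cong (λ c → k * (c + L)) (∣⁅x⁆∣≡1 w) ⟩
        k * suc L                         ≡⟨ *-suc k L ⟩
        k + k * L                         ∎)
        where
        open ≤-Reasoning
        M = maximalMatching H nonempty (edge H e ∪ edge H f) (allFin (m H))
        L = length (matched M)
        w≻e∪f : Dominates H 1 ⁅ w ⁆ (edge H e ∪ edge H f)
        w≻e∪f x x∈e∪f with x∈p∪q⁻ (edge H e) (edge H f) x∈e∪f
        ... | inj₁ x∈e = w , x∈⁅x⁆ w , edge⇒InBall₁ H w∈e x∈e
        ... | inj₂ x∈f = w , x∈⁅x⁆ w , edge⇒InBall₁ H w∈f x∈f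

      meeting-edges⇒≡ : ∀ {w e f} → w ∈ edge H e → w ∈ edge H f → edge H e ≡ edge H f
      meeting-edges⇒≡ {w} {e} {f} w∈e w∈f =
        trans (≡e∪f (p⊆p∪q (edge H f))) (sym (≡e∪f (q⊆p∪q (edge H e) _)))
        where
        ≡e∪f : ∀ {g} → edge H g ⊆ edge H e ∪ edge H f → edge H g ≡ edge H e ∪ edge H f
        ≡e∪f {g} g⊆e∪f =
          p⊆q⇒∣q∣≤∣p∣⇒p≡q g⊆e∪f (subst (_ ≤_) (sym (uniform g)) (meeting-edges⇒∣∪∣≤k w∈e w∈f))

      IsDisjointUnionOfEdges-γ : IsDisjointUnionOfEdges H γ
      IsDisjointUnionOfEdges-γ =
        subst (IsDisjointUnionOfEdges H) ∣matching₀∣≡γ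
          (MaximalMatching⇒IsDisjointUnionOfEdges H matching₀ meeting-edges⇒≡)
        where
        ∣matching₀∣≡γ : length (matched matching₀) ≡ γ
        ∣matching₀∣≡γ =
          ≤-antisym (*-cancelˡ-≤ k {{>-nonZero 1≤k}} (≤-trans k*∣matching₀∣≤n n≤k*γ)) γ≤∣matching₀∣

data Split (k : ℕ) {r : ℕ} : Fin (k + r) → Set where
  left  : ∀ a → Split k (a ↑ˡ r)
  right : ∀ b → Split k (k ↑ʳ b)

split : ∀ k {r} (x : Fin (k + r)) → Split k x
split zero    x       = right x
split (suc k) zero    = left zero
split (suc k) (suc x) with split k x
... | left a  = left (suc a)
... | right b = right b

∈-++⁺ˡ : ∀ {k r a} (p : Subset k) (q : Subset r) → a ∈ p → a ↑ˡ r ∈ p ++ q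
∈-++⁺ˡ (_ ∷ p) q here         = here
∈-++⁺ˡ (_ ∷ p) q (there a∈p)  = there (∈-++⁺ˡ p q a∈p)

∈-++⁻ˡ : ∀ {k r} a (p : Subset k) (q : Subset r) → a ↑ˡ r ∈ p ++ q → a ∈ p
∈-++⁻ˡ zero    (_ ∷ p) q here       = here
∈-++⁻ˡ (suc a) (_ ∷ p) q (there a∈) = there (∈-++⁻ˡ a p q a∈)

∈-++⁺ʳ : ∀ {k r b} (p : Subset k) (q : Subset r) → b ∈ q → k ↑ʳ b ∈ p ++ q
∈-++⁺ʳ []      q b∈q = b∈q
∈-++⁺ʳ (_ ∷ p) q b∈q = there (∈-++⁺ʳ p q b∈q)

∈-++⁻ʳ : ∀ {k r b} (p : Subset k) (q : Subset r) → k ↑ʳ b ∈ p ++ q → b ∈ q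
∈-++⁻ʳ []      q b∈q         = b∈q
∈-++⁻ʳ (_ ∷ p) q (there b∈)  = ∈-++⁻ʳ p q b∈

∣p++q∣≡∣p∣+∣q∣ : ∀ {k r} (p : Subset k) (q : Subset r) → ∣ p ++ q ∣ ≡ ∣ p ∣ + ∣ q ∣
∣p++q∣≡∣p∣+∣q∣ []            q = refl
∣p++q∣≡∣p∣+∣q∣ (inside  ∷ p) q = cong suc (∣p++q∣≡∣p∣+∣q∣ p q)
∣p++q∣≡∣p∣+∣q∣ (outside ∷ p) q = ∣p++q∣≡∣p∣+∣q∣ p q

module _ (k : ℕ) where

  block : ∀ g → Fin g → Subset (g * k)
  block (suc g) zero    = ⊤ {k} ++ ⊥ {g * k}
  block (suc g) (suc i) = ⊥ {k} ++ block g i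

  blocks : ∀ g → Hypergraph (g * k)
  blocks g = record { m = g ; edge = block g }

  blockOf : ∀ g → Fin (g * k) → Fin g
  blockOf (suc g) x with split k x
  ... | left _  = zero
  ... | right b = suc (blockOf g b)

  ∈-block-blockOf : ∀ g x → x ∈ block g (blockOf g x)
  ∈-block-blockOf (suc g) x with split k x
  ... | left a  = ∈-++⁺ˡ ⊤ (⊥ {g * k}) ∈⊤
  ... | right b = ∈-++⁺ʳ (⊥ {k}) _ (∈-block-blockOf g b)

  ∈-block⇒blockOf : ∀ g {x} i → x ∈ block g i → blockOf g x ≡ i
  ∈-block⇒blockOf (suc g) {x} zero x∈i with split k x
  ... | left a  = refl
  ... | right b = contradiction (∈-++⁻ʳ (⊤ {k}) ⊥ x∈i) ∉⊥
  ∈-block⇒blockOf (suc g) {x} (suc i) x∈i with split k x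
  ... | left a  = contradiction (∈-++⁻ˡ a (⊥ {k}) _ x∈i) ∉⊥
  ... | right b = cong suc (∈-block⇒blockOf g i (∈-++⁻ʳ (⊥ {k}) _ x∈i))

  blocks-uniform : ∀ g → Uniform k (blocks g)
  blocks-uniform (suc g) zero    = begin
    ∣ block (suc g) zero ∣        ≡⟨ ∣p++q∣≡∣p∣+∣q∣ (⊤ {k}) (⊥ {g * k}) ⟩
    ∣ ⊤ {k} ∣ + ∣ ⊥ {g * k} ∣     ≡⟨ cong₂ _+_ (∣⊤∣≡n k) (∣⊥∣≡0 (g * k)) ⟩
    k + 0                         ≡⟨ +-identityʳ k ⟩
    k                             ∎
    where open ≡-Reasoning
  blocks-uniform (suc g) (suc i) = begin
    ∣ block (suc g) (suc i) ∣     ≡⟨ ∣p++q∣≡∣p∣+∣q∣ (⊥ {k}) (block g i) ⟩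
    ∣ ⊥ {k} ∣ + ∣ block g i ∣     ≡⟨ cong₂ _+_ (∣⊥∣≡0 k) (blocks-uniform g i) ⟩
    k                             ∎
    where open ≡-Reasoning

  blocks-noIsolated : ∀ g → NoIsolated (blocks g)
  blocks-noIsolated g x = blockOf g x , ∈-block-blockOf g x

  block-disjoint : ∀ g → PairwiseDisjoint (block g)
  block-disjoint g i j i≢j x x∈i x∈j =
    i≢j (trans (sym (∈-block⇒blockOf g i x∈i)) (∈-block⇒blockOf g j x∈j))

  blocks-DomNumberAtLeast : 1 ≤ k → ∀ g l → DomNumberAtLeast (blocks g) l g
  blocks-DomNumberAtLeast 1≤k g =
    PairwiseDisjoint⇒DomNumberAtLeast (blocks g) (block-disjoint g) (Uniform⇒Nonempty (blocks-uniform g) 1≤k)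

proposition1 : (k l γ : ℕ) → 2 ≤ k → 2 ≤ l → 1 ≤ γ →
    (Σ (Hypergraph (k * γ)) λ H →
        Uniform k H × NoIsolated H × DomNumberAtLeast H l γ)
    × (∀ n (H : Hypergraph n) → Uniform k H → NoIsolated H → DomNumberAtLeast H l γ →
        k * γ ≤ n)
    × (∀ (H : Hypergraph (k * γ)) → Uniform k H → NoIsolated H → DomNumberAtLeast H l γ →
        IsDisjointUnionOfEdges H γ)
proposition1 k l γ 2≤k 2≤l _ =
    subst (λ N → Σ (Hypergraph N) λ H → Uniform k H × NoIsolated H × DomNumberAtLeast H l γ) (*-comm γ k)
      (blocks k γ , blocks-uniform k γ , blocks-noIsolated k γ , blocks-DomNumberAtLeast k 1≤k γ l)
  , (λ _ _ uniform noIsolated γ≤γd → k*γ≤n uniform 1≤k noIsolated 2≤l γ≤γd)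
  , (λ _ uniform noIsolated γ≤γd → IsDisjointUnionOfEdges-γ uniform 1≤k noIsolated 2≤l γ≤γd ≤-refl)
  where
  1≤k : 1 ≤ k
  1≤k = <⇒≤ 2≤k
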